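{- Let $I$ be a regular icosahedron in $\mathbb{R}^{3}$ centred at the origin, with vertex set $V$ ($12$ vertices) and face set $F$ ($20$ triangular faces). Let $[V]$ be the set of $6$ antipodal pairs $\{v,-v\}$ of vertices and $[F]$ the set of $10$ antipodal pairs $\{f,-f\}$ of faces. Let $\Pi_{I}$ be the undirected bipartite graph with vertex set $[V]\cup[F]$ ($16$ vertices) in which a class $[v]\in[V]$ is adjacent to a class $[f]\in[F]$ if and only if some vertex of $I$ in the class $[v]$ lies on some face of $I$ in the class $[f]$. Then the automorphism group of $\Pi_{I}$ is isomorphic to the alternating group $A_{5}$.
   Context: For a point or subset $S\subseteq\mathbb{R}^3\setminus\{0\}$, $[S]$ denotes its image in the real projective plane $P(\mathbb{R}^{3})$; since $I$ is centrally symmetric about the origin, the projective class of a vertex (resp. face) of $I$ is the antipodal pair containing it. $\Pi_I$ is called the projective vertex-face graph of $I$ (it is the vertex-face incidence graph of the hemi-icosahedron). Automorphisms are graph automorphisms of the undirected graph (not required to preserve the bipartition a priori). -}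

module Defs where

open import Data.Nat as ℕ using (ℕ; _%_)
open import Data.Integer as ℤ using (ℤ; +_; -[1+_])
open import Data.Fin using (Fin; zero; suc; _<?_; _↑ˡ_; _↑ʳ_; #_)
open import Data.Fin.Permutation using (Permutation′; _⟨$⟩ʳ_)
open import Data.Product using (Σ; Σ-syntax; ∃; ∃-syntax; _×_; _,_; proj₁; proj₂)
open import Data.Sum using (_⊎_; inj₁; inj₂)
open import Data.Empty using (⊥)
open import Data.List using (List; allFin; map)
open import Data.Nat.ListAction using (sum)
open import Data.Vec using (Vec; []; _∷_; lookup)
open import Data.Bool using (Bool; true; false; if_then_else_)
open import Relation.Nullary using (does)
open import Function.Bundles using (_↔_; Inverse; _⇔_)
open import Function.Construct.Composition using (_↔-∘_; _⇔-∘_)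
open import Relation.Binary.PropositionalEquality using (_≡_; refl)
import Data.Fin

-- The ring ℤ[φ], φ = (1+√5)/2 the golden ratio, φ² = φ + 1.
-- An element (a , b) represents a + bφ (representation is unique since
-- φ is irrational), so ≡ on pairs is equality of real numbers.

ℤφ : Set
ℤφ = ℤ × ℤ

0φ 1φ φ : ℤφ
0φ = (+ 0 , + 0)
1φ = (+ 1 , + 0)
φ  = (+ 0 , + 1)

-φ_ : ℤφ → ℤφ
-φ (a , b) = (ℤ.- a , ℤ.- b)

_+φ_ : ℤφ → ℤφ → ℤφ
(a , b) +φ (c , d) = (a ℤ.+ c , b ℤ.+ d)

-- (a + bφ)(c + dφ) = (ac + bd) + (ad + bc + bd)φ
_*φ_ : ℤφ → ℤφ → ℤφ
(a , b) *φ (c , d) = (a ℤ.* c ℤ.+ b ℤ.* d , a ℤ.* d ℤ.+ b ℤ.* c ℤ.+ b ℤ.* d)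

Point : Set
Point = ℤφ × ℤφ × ℤφ

negP : Point → Point
negP (x , y , z) = (-φ x , -φ y , -φ z)

sqDist : Point → Point → ℤφ
sqDist (x , y , z) (x' , y' , z') =
  let dx = x +φ (-φ x') ; dy = y +φ (-φ y') ; dz = z +φ (-φ z')
  in (dx *φ dx) +φ ((dy *φ dy) +φ (dz *φ dz))

-- The regular icosahedron I centred at the origin, with vertices the
-- cyclic permutations of (0, ±1, ±φ) (edge length 2).
-- Vertex i+6 is the antipode of vertex i (i < 6).

vertex : Fin 12 → Point
vertex i = lookup vs i
  where
  vs : Vec Point 12
  vs = (0φ , 1φ , φ) ∷ (0φ , -φ 1φ , φ) ∷ (1φ , φ , 0φ) ∷ (-φ 1φ , φ , 0φ)
     ∷ (φ , 0φ , 1φ) ∷ (-φ φ , 0φ , 1φ)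
     ∷ (0φ , -φ 1φ , -φ φ) ∷ (0φ , 1φ , -φ φ) ∷ (-φ 1φ , -φ φ , 0φ) ∷ (1φ , -φ φ , 0φ)
     ∷ (-φ φ , 0φ , -φ 1φ) ∷ (φ , 0φ , -φ 1φ) ∷ []

Face : Set
Face = Point × Point × Point

negF : Face → Face
negF (p , q , r) = (negP p , negP q , negP r)

_liesOn_ : Point → Face → Set
p liesOn (a , b , c) = (p ≡ a) ⊎ (p ≡ b) ⊎ (p ≡ c)

-- One representative face from each of the 10 antipodal pairs of faces
-- of I; the other 10 faces are their negations (20 faces in total).
faceRep : Fin 10 → Face
faceRep j = tri (lookup fs j)
  where
  tri : Fin 12 × Fin 12 × Fin 12 → Face
  tri (a , b , c) = (vertex a , vertex b , vertex c)
  fs : Vec (Fin 12 × Fin 12 × Fin 12) 10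
  fs = (# 0 , # 1 , # 4) ∷ (# 0 , # 1 , # 5) ∷ (# 0 , # 2 , # 3) ∷ (# 0 , # 2 , # 4) ∷ (# 0 , # 3 , # 5)
     ∷ (# 1 , # 4 , # 9) ∷ (# 1 , # 5 , # 8) ∷ (# 1 , # 8 , # 9) ∷ (# 2 , # 4 , # 11) ∷ (# 3 , # 5 , # 10) ∷ []

inVClass : Fin 6 → Point → Set
inVClass i p = (p ≡ vertex (i ↑ˡ 6)) ⊎ (p ≡ negP (vertex (i ↑ˡ 6)))

inFClass : Fin 10 → Face → Set
inFClass j f = (f ≡ faceRep j) ⊎ (f ≡ negF (faceRep j))

ΠVertex : Set
ΠVertex = Fin 6 ⊎ Fin 10

Incident : Fin 6 → Fin 10 → Set
Incident i j = Σ[ p ∈ Point ] Σ[ f ∈ Face ] inVClass i p × inFClass j f × p liesOn f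

Adj : ΠVertex → ΠVertex → Set
Adj (inj₁ i) (inj₂ j) = Incident i j
Adj (inj₂ j) (inj₁ i) = Incident i j
Adj (inj₁ _) (inj₁ _) = ⊥
Adj (inj₂ _) (inj₂ _) = ⊥

record Aut : Set where
  field
    perm     : ΠVertex ↔ ΠVertex
    preserve : ∀ x y → Adj x y ⇔ Adj (Inverse.to perm x) (Inverse.to perm y)

open Aut public

_≈Aut_ : Aut → Aut → Set
a ≈Aut b = ∀ x → Inverse.to (perm a) x ≡ Inverse.to (perm b) x

-- composition (a ∘ b)(x) = a (b x)
_∘Aut_ : Aut → Aut → Aut
perm (a ∘Aut b) = perm a ↔-∘ perm b
preserve (a ∘Aut b) x y =
  preserve a (Inverse.to (perm b) x) (Inverse.to (perm b) y) ⇔-∘ preserve b x y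

inversions : Permutation′ 5 → ℕ
inversions π = sum (map (λ i → sum (map (λ j → inv i j) (allFin 5))) (allFin 5))
  where
  inv : Fin 5 → Fin 5 → ℕ
  inv i j = if does (i <? j) then (if does ((π ⟨$⟩ʳ j) <? (π ⟨$⟩ʳ i)) then 1 else 0) else 0

IsEven : Permutation′ 5 → Set
IsEven π = inversions π % 2 ≡ 0

A₅ : Set
A₅ = Σ[ π ∈ Permutation′ 5 ] IsEven π

_≈A₅_ : A₅ → A₅ → Set
σ ≈A₅ τ = ∀ i → proj₁ σ ⟨$⟩ʳ i ≡ proj₁ τ ⟨$⟩ʳ i

record AutIsoA₅ : Set where
  field
    to      : Aut → A₅
    from    : A₅ → Aut
    to-cong   : ∀ {a b} → a ≈Aut b → to a ≈A₅ to b
    from-cong : ∀ {σ τ} → σ ≈A₅ τ → from σ ≈Aut from τ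
    to-from : ∀ σ → to (from σ) ≈A₅ σ
    from-to : ∀ a → from (to a) ≈Aut a
    homo    : ∀ a b i → proj₁ (to (a ∘Aut b)) ⟨$⟩ʳ i
                          ≡ proj₁ (to a) ⟨$⟩ʳ (proj₁ (to b) ⟨$⟩ʳ i)

-- Sanity checks on the data (not used by the statement).

antipodes-ok : ∀ i → vertex (6 ↑ʳ i) ≡ negP (vertex (i ↑ˡ 6))
antipodes-ok zero = refl
antipodes-ok (suc zero) = refl
antipodes-ok (suc (suc zero)) = refl
antipodes-ok (suc (suc (suc zero))) = refl
antipodes-ok (suc (suc (suc (suc zero)))) = refl
antipodes-ok (suc (suc (suc (suc (suc zero))))) = refl

edge : ℤφ
edge = (+ 4 , + 0)

faces-ok : ∀ j → let (p , q , r) = faceRep j in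
  (sqDist p q ≡ edge) × (sqDist q r ≡ edge) × (sqDist p r ≡ edge)
faces-ok zero = refl , refl , refl
faces-ok (suc zero) = refl , refl , refl
faces-ok (suc (suc zero)) = refl , refl , refl
faces-ok (suc (suc (suc zero))) = refl , refl , refl
faces-ok (suc (suc (suc (suc zero)))) = refl , refl , refl
faces-ok (suc (suc (suc (suc (suc zero))))) = refl , refl , refl
faces-ok (suc (suc (suc (suc (suc (suc zero)))))) = refl , refl , refl
faces-ok (suc (suc (suc (suc (suc (suc (suc zero))))))) = refl , refl , refl
faces-ok (suc (suc (suc (suc (suc (suc (suc (suc zero)))))))) = refl , refl , refl
faces-ok (suc (suc (suc (suc (suc (suc (suc (suc (suc zero))))))))) = refl , refl , refl

-- Label the ten face classes by the 2-subsets of {0,…,4} so that two faces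
-- sharing an edge get disjoint labels; the face classes then form the Petersen
-- graph, and the five faces around a vertex class form one of its pentagons.
-- A permutation σ of {0,…,4} permutes the face classes, and this extends to
-- the vertex classes exactly when σ maps the six pentagons that occur onto
-- each other, i.e. when σ is even (odd permutations swap these six with the
-- other six pentagons). The extension is unique because distinct vertex
-- classes have distinct sets of faces, and σ is recovered from its action on
-- the faces, so this embeds A₅ into Aut(Π_I). A verified backtracking search
-- shows that every automorphism arises this way.

module Submission where

open import Defs
open import Data.Bool as Bool using (Bool; true; false; T; _∧_; _∨_; not; if_then_else_)
open import Data.Bool.ListAction using (all; any)
open import Data.Bool.Properties using (T-∧; T-≡)
open import Data.Empty using (⊥-elim)
open import Data.Fin as Fin using (Fin; zero; suc; #_; _<?_)
open import Data.Fin.Permutation using (Permutation′; _⟨$⟩ʳ_; _⟨$⟩ˡ_; inverseˡ; inverseʳ; flip)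
open import Data.Fin.Properties using (all?)
import Data.Integer as ℤ
open import Data.List using (List; []; _∷_; map; filter; allFin; _++_)
open import Data.List.Membership.Propositional using (_∈_)
open import Data.List.Membership.Propositional.Properties using (∈-allFin; ∈-map⁺; ∈-++⁺ˡ; ∈-++⁺ʳ; ∈-filter⁺)
open import Data.List.Properties using (map-cong)
open import Data.List.Relation.Unary.All using (All; []; _∷_)
open import Data.List.Relation.Unary.Any using (here; there)
open import Data.Nat as ℕ using (ℕ; zero; suc; _%_)
open import Data.Nat.ListAction using (sum)
open import Data.Product using (Σ-syntax; ∃-syntax; _×_; _,_; proj₁; proj₂)
import Data.Product.Properties as Product
open import Data.Sum using (_⊎_; inj₁; inj₂)
open import Data.Sum.Properties as Sum using (inj₂-injective)
open import Data.Unit using (tt)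
open import Data.Vec using ([]; _∷_; lookup; tabulate)
open import Data.Vec.Properties using (lookup∘tabulate)
import Data.Vec.Functional as Functional
open import Function using (_∘_; id; Injective; _⇔_; _↔_; mk⇔; mk↔ₛ′; Equivalence; Inverse)
open import Function.Construct.Composition using (_⇔-∘_)
open import Function.Construct.Symmetry using (⇔-sym)
open import Function.Properties.Inverse using (↔⇒↣)
open import Function.Bundles using (Injection)
open import Relation.Nullary using (Dec; yes; no; does)
open import Relation.Nullary.Decidable
  using (isYes; T?; map′; _⊎-dec_; _→-dec_; ¬?; from-yes; toWitness; fromWitness)
open import Relation.Binary.Definitions using (DecidableEquality)
open import Relation.Binary.PropositionalEquality
  using (_≡_; _≢_; refl; sym; trans; cong; cong₂; subst; _≗_; module ≡-Reasoning)

to-injective : ∀ {A B : Set} (π : A ↔ B) → Injective _≡_ _≡_ (Inverse.to π)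
to-injective π = Injection.injective (↔⇒↣ π)

_⇒ᵇ_ : Bool → Bool → Bool
x ⇒ᵇ y = not x ∨ y

⇒ᵇ-elim : ∀ {x y} → T (x ⇒ᵇ y) → T x → T y
⇒ᵇ-elim {true} t _ = t

T-injective : ∀ {x y} → (T x ⇔ T y) → x ≡ y
T-injective {false} {false} _ = refl
T-injective {false} {true}  e = ⊥-elim (Equivalence.from e tt)
T-injective {true}  {false} e = ⊥-elim (Equivalence.to e tt)
T-injective {true}  {true}  _ = refl

allᵇ : ∀ {n} → (Fin n → Bool) → Bool
allᵇ {zero}  p = true
allᵇ {suc n} p = p zero ∧ allᵇ (p ∘ suc)

allᵇ-sound : ∀ {n} (p : Fin n → Bool) → T (allᵇ p) → ∀ i → T (p i)
allᵇ-sound p t zero    = proj₁ (Equivalence.to T-∧ t)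
allᵇ-sound p t (suc i) = allᵇ-sound (p ∘ suc) (proj₂ (Equivalence.to T-∧ t)) i

allᵇ-complete : ∀ {n} (p : Fin n → Bool) → (∀ i → T (p i)) → T (allᵇ p)
allᵇ-complete {zero}  p h = tt
allᵇ-complete {suc n} p h = Equivalence.from T-∧ (h zero , allᵇ-complete (p ∘ suc) (h ∘ suc))

allᵇ-cong : ∀ {n} {p q : Fin n → Bool} → p ≗ q → allᵇ p ≡ allᵇ q
allᵇ-cong {zero}  e = refl
allᵇ-cong {suc n} e = cong₂ _∧_ (e zero) (allᵇ-cong (e ∘ suc))

find : ∀ {n} → (Fin (suc n) → Bool) → Fin (suc n)
find {zero}  p = zero
find {suc n} p = if p zero then zero else suc (find (p ∘ suc))

find-cong : ∀ {n} {p q : Fin (suc n) → Bool} → p ≗ q → find p ≡ find q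
find-cong {zero}  e = refl
find-cong {suc n} {p} {q} e rewrite e zero with q zero
... | true  = refl
... | false = cong suc (find-cong (e ∘ suc))

allFunctionsᵇ : ∀ {m n} → ((Fin m → Fin n) → Bool) → Bool
allFunctionsᵇ {zero}  P = P λ ()
allFunctionsᵇ {suc m} P = allᵇ λ a → allFunctionsᵇ λ g → P (a Functional.∷ g)

-- Checks are stated as `≡ true` and proved by refl so that they are evaluated
-- once; implicit arguments of lemmas about them are given explicitly below for
-- the same reason, since unification would otherwise unfold the checks.
allFunctionsᵇ-sound : ∀ {m n} (P : (Fin m → Fin n) → Bool) → (∀ {σ τ} → σ ≗ τ → P σ ≡ P τ) →
                      allFunctionsᵇ P ≡ true → ∀ σ → T (P σ)
allFunctionsᵇ-sound P P-cong t = sound P P-cong (Equivalence.from T-≡ t)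
  where
  sound : ∀ {m n} (P : (Fin m → Fin n) → Bool) → (∀ {σ τ} → σ ≗ τ → P σ ≡ P τ) →
          T (allFunctionsᵇ P) → ∀ σ → T (P σ)
  sound {zero}  P P-cong t σ = subst T (P-cong λ ()) t
  sound {suc m} P P-cong t σ = subst T (P-cong head∷tail) (sound
    (λ g → P (σ zero Functional.∷ g)) (λ e → P-cong (∷-cong e)) (allᵇ-sound _ t (σ zero)) (σ ∘ suc))
    where
    head∷tail : (σ zero Functional.∷ σ ∘ suc) ≗ σ
    head∷tail zero    = refl
    head∷tail (suc i) = refl
    ∷-cong : ∀ {g h : Fin m → _} → g ≗ h → (σ zero Functional.∷ g) ≗ (σ zero Functional.∷ h)
    ∷-cong e zero    = refl
    ∷-cong e (suc i) = e i

-- Tabulating a function before a search lets the evaluator share its values.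
memo : ∀ {A : Set} {n} → (Fin n → A) → Fin n → A
memo f = lookup (tabulate f)

memo-correct : ∀ {A : Set} {n} (f : Fin n → A) → memo f ≗ f
memo-correct = lookup∘tabulate

memo-cong : ∀ {A : Set} {n} {f g : Fin n → A} → f ≗ g → memo f ≗ memo g
memo-cong {f = f} {g} e i = trans (memo-correct f i) (trans (e i) (sym (memo-correct g i)))

_==_ : ∀ {n} → Fin n → Fin n → Bool
i == j = isYes (i Fin.≟ j)

T-all : ∀ {A : Set} (p : A → Bool) {xs x} → T (all p xs) → x ∈ xs → T (p x)
T-all p {_ ∷ _} t (here refl) = proj₁ (Equivalence.to T-∧ t)
T-all p {_ ∷ _} t (there x∈)  = T-all p (proj₂ (Equivalence.to T-∧ t)) x∈

module Backtracking {V : Set} (_≟_ : DecidableEquality V)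
                    (vertices : List V) (∈-vertices : ∀ x → x ∈ vertices)
                    (adj : V → V → Bool) (leaf : (V → V) → Bool) where

  Assignment : Set
  Assignment = List (V × V)

  private
    _≡ᵇ_ : Bool → Bool → Bool
    b ≡ᵇ c = isYes (b Bool.≟ c)

    same : V → V → Bool
    same x y = isYes (x ≟ y)

  compatible : V → V → V × V → Bool
  compatible x z (y , c) = (adj x y ≡ᵇ adj z c) ∧ (same x y ≡ᵇ same z c)

  candidates : Assignment → V → List V
  candidates ks x = filter (λ z → T? (all (compatible x z) ks)) vertices

  assigned : Assignment → V → Bool
  assigned ks x = any (λ (y , _) → same x y) ks

  image : Assignment → V → V
  image []             x = x
  image ((y , c) ∷ ks) x = if same x y then c else image ks x

  searchᵇ : List V → Assignment → Bool
  searchᵇ []          ks = all (assigned ks) vertices ∧ leaf (image ks)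
  searchᵇ (x ∷ order) ks = all (λ z → searchᵇ order ((x , z) ∷ ks)) (candidates ks x)

  module _ (f : V → V) (f-adj : ∀ x y → adj x y ≡ adj (f x) (f y))
           (f-injective : Injective _≡_ _≡_ f) where

    Extends : Assignment → Set
    Extends = All λ (y , c) → f y ≡ c

    same-preserved : ∀ x y → same x y ≡ same (f x) (f y)
    same-preserved x y with x ≟ y | f x ≟ f y
    ... | yes _   | yes _     = refl
    ... | yes x≡y | no fx≢fy  = ⊥-elim (fx≢fy (cong f x≡y))
    ... | no x≢y  | yes fx≡fy = ⊥-elim (x≢y (f-injective fx≡fy))
    ... | no _    | no _      = refl

    image-extends : ∀ ks x → Extends ks → T (assigned ks x) → f x ≡ image ks x
    image-extends ((y , c) ∷ ks) x (fy≡c ∷ ext) t with x ≟ y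
    ... | yes refl = fy≡c
    ... | no _     = image-extends ks x ext t

    compatible-image : ∀ ks x → Extends ks → T (all (compatible x (f x)) ks)
    compatible-image []             x []           = tt
    compatible-image ((y , c) ∷ ks) x (refl ∷ ext) = Equivalence.from T-∧
      ( Equivalence.from T-∧
          ( fromWitness {a? = adj x y Bool.≟ adj (f x) (f y)} (f-adj x y)
          , fromWitness {a? = same x y Bool.≟ same (f x) (f y)} (same-preserved x y) )
      , compatible-image ks x ext )

    private
      sound : ∀ order ks → Extends ks → T (searchᵇ order ks) → ∃[ g ] f ≗ g × T (leaf g)
      sound [] ks ext t = image ks , agree , proj₂ (Equivalence.to T-∧ t)
        where
        agree : f ≗ image ks
        agree x = image-extends ks x ext
          (T-all (assigned ks) (proj₁ (Equivalence.to T-∧ t)) (∈-vertices x))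
      sound (x ∷ order) ks ext t =
        sound order ((x , f x) ∷ ks) (refl ∷ ext)
          (T-all (λ z → searchᵇ order ((x , z) ∷ ks)) t
            (∈-filter⁺ (λ z → T? (all (compatible x z) ks)) (∈-vertices (f x))
                       (compatible-image ks x ext)))

    search-sound : ∀ order → searchᵇ order [] ≡ true → ∃[ g ] f ≗ g × T (leaf g)
    search-sound order t = sound order [] [] (Equivalence.from T-≡ t)

-- Π_I as the incidence graph of the hemi-icosahedron

_≟ᵖ_ : DecidableEquality Point
_≟ᵖ_ = Product.≡-dec ℤφ-≟ (Product.≡-dec ℤφ-≟ ℤφ-≟)
  where
  ℤφ-≟ : DecidableEquality ℤφ
  ℤφ-≟ = Product.≡-dec ℤ._≟_ ℤ._≟_

liesOn? : ∀ p f → Dec (p liesOn f)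
liesOn? p (a , b , c) = (p ≟ᵖ a) ⊎-dec ((p ≟ᵖ b) ⊎-dec (p ≟ᵖ c))

incident? : ∀ i j → Dec (Incident i j)
incident? i j = map′ fromCases toCases
  (liesOn? _ _ ⊎-dec (liesOn? _ _ ⊎-dec (liesOn? _ _ ⊎-dec liesOn? _ _)))
  where
  v : Point
  v = vertex (i Fin.↑ˡ 6)
  Cases : Set
  Cases = (v liesOn faceRep j) ⊎ (v liesOn negF (faceRep j))
        ⊎ (negP v liesOn faceRep j) ⊎ (negP v liesOn negF (faceRep j))
  fromCases : Cases → Incident i j
  fromCases (inj₁ l)               = _ , _ , inj₁ refl , inj₁ refl , l
  fromCases (inj₂ (inj₁ l))        = _ , _ , inj₁ refl , inj₂ refl , l
  fromCases (inj₂ (inj₂ (inj₁ l))) = _ , _ , inj₂ refl , inj₁ refl , l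
  fromCases (inj₂ (inj₂ (inj₂ l))) = _ , _ , inj₂ refl , inj₂ refl , l
  toCases : Incident i j → Cases
  toCases (_ , _ , inj₁ refl , inj₁ refl , l) = inj₁ l
  toCases (_ , _ , inj₁ refl , inj₂ refl , l) = inj₂ (inj₁ l)
  toCases (_ , _ , inj₂ refl , inj₁ refl , l) = inj₂ (inj₂ (inj₁ l))
  toCases (_ , _ , inj₂ refl , inj₂ refl , l) = inj₂ (inj₂ (inj₂ l))

-- faceRep with every vertex replaced by its antipodal class
faceTriple : Fin 10 → Fin 6 × Fin 6 × Fin 6
faceTriple = lookup
  ( (# 0 , # 1 , # 4) ∷ (# 0 , # 1 , # 5) ∷ (# 0 , # 2 , # 3) ∷ (# 0 , # 2 , # 4) ∷ (# 0 , # 3 , # 5)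
  ∷ (# 1 , # 4 , # 3) ∷ (# 1 , # 5 , # 2) ∷ (# 1 , # 2 , # 3) ∷ (# 2 , # 4 , # 5) ∷ (# 3 , # 5 , # 4) ∷ [])

incident : Fin 6 → Fin 10 → Bool
incident i j with faceTriple j
... | (a , b , c) = (i == a) ∨ (i == b) ∨ (i == c)

incident?-agrees : ∀ i j → isYes (incident? i j) ≡ incident i j
incident?-agrees = from-yes (all? λ i → all? λ j → isYes (incident? i j) Bool.≟ incident i j)

incident-correct : ∀ i j → Incident i j ⇔ T (incident i j)
incident-correct i j = mk⇔
  (λ p → subst T (incident?-agrees i j) (fromWitness {a? = incident? i j} p))
  (λ t → toWitness {a? = incident? i j} (subst T (sym (incident?-agrees i j)) t))

incident-injective : ∀ i i' → (∀ j → incident i j ≡ incident i' j) → i ≡ i'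
incident-injective = from-yes (all? λ i → all? λ i' →
  all? (λ j → incident i j Bool.≟ incident i' j) →-dec (i Fin.≟ i'))

adj : ΠVertex → ΠVertex → Bool
adj (inj₁ i) (inj₂ j) = incident i j
adj (inj₂ j) (inj₁ i) = incident i j
adj (inj₁ _) (inj₁ _) = false
adj (inj₂ _) (inj₂ _) = false

adj-correct : ∀ x y → Adj x y ⇔ T (adj x y)
adj-correct (inj₁ i) (inj₂ j) = incident-correct i j
adj-correct (inj₂ j) (inj₁ i) = incident-correct i j
adj-correct (inj₁ _) (inj₁ _) = mk⇔ (λ ()) (λ ())
adj-correct (inj₂ _) (inj₂ _) = mk⇔ (λ ()) (λ ())

Adj-preserved : (g : ΠVertex → ΠVertex) → (∀ x y → adj x y ≡ adj (g x) (g y)) →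
                ∀ x y → Adj x y ⇔ Adj (g x) (g y)
Adj-preserved g g-adj x y = mk⇔
  (Equivalence.from (adj-correct _ _) ∘ subst T (g-adj x y) ∘ Equivalence.to (adj-correct x y))
  (Equivalence.from (adj-correct x y) ∘ subst T (sym (g-adj x y)) ∘ Equivalence.to (adj-correct _ _))

aut-adj : (a : Aut) → ∀ x y → adj x y ≡ adj (Inverse.to (perm a) x) (Inverse.to (perm a) y)
aut-adj a x y = T-injective (adj-correct _ _ ⇔-∘ (preserve a x y ⇔-∘ ⇔-sym (adj-correct x y)))

-- S₅ acting on the face classes

facePair : Fin 10 → Fin 5 × Fin 5
facePair = lookup
  ( (# 0 , # 1) ∷ (# 2 , # 3) ∷ (# 0 , # 2) ∷ (# 3 , # 4) ∷ (# 1 , # 4)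
  ∷ (# 2 , # 4) ∷ (# 0 , # 4) ∷ (# 1 , # 3) ∷ (# 1 , # 2) ∷ (# 0 , # 3) ∷ [])

faceOf : Fin 5 → Fin 5 → Fin 10
faceOf a b = find λ j → let (c , d) = facePair j in (c == a ∧ d == b) ∨ (c == b ∧ d == a)

facePair-distinct : ∀ j → proj₁ (facePair j) ≢ proj₂ (facePair j)
facePair-distinct = from-yes (all? λ j → ¬? (proj₁ (facePair j) Fin.≟ proj₂ (facePair j)))

faceOf-facePair : ∀ j → faceOf (proj₁ (facePair j)) (proj₂ (facePair j)) ≡ j
faceOf-facePair = from-yes (all? λ j → faceOf (proj₁ (facePair j)) (proj₂ (facePair j)) Fin.≟ j)

faceOf-comm : ∀ a b → faceOf a b ≡ faceOf b a
faceOf-comm = from-yes (all? λ a → all? λ b → faceOf a b Fin.≟ faceOf b a)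

facePair-faceOf : ∀ a b → a ≢ b → facePair (faceOf a b) ≡ (a , b) ⊎ facePair (faceOf a b) ≡ (b , a)
facePair-faceOf = from-yes (all? λ a → all? λ b → ¬? (a Fin.≟ b) →-dec
  (pair-≟ (facePair (faceOf a b)) (a , b) ⊎-dec pair-≟ (facePair (faceOf a b)) (b , a)))
  where
  pair-≟ : DecidableEquality (Fin 5 × Fin 5)
  pair-≟ = Product.≡-dec Fin._≟_ Fin._≟_

onFaces : (Fin 5 → Fin 5) → Fin 10 → Fin 10
onFaces σ j = faceOf (σ (proj₁ (facePair j))) (σ (proj₂ (facePair j)))

onFaces-cong : ∀ {σ τ} → σ ≗ τ → onFaces σ ≗ onFaces τ
onFaces-cong e j = cong₂ faceOf (e _) (e _)

onFaces-id : onFaces id ≗ id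
onFaces-id = faceOf-facePair

onFaces-∘ : ∀ σ τ → Injective _≡_ _≡_ τ → onFaces (σ ∘ τ) ≗ onFaces σ ∘ onFaces τ
onFaces-∘ σ τ τ-injective j =
  reorder (facePair-faceOf (τ c) (τ d) (facePair-distinct j ∘ τ-injective))
  where
  c = proj₁ (facePair j)
  d = proj₂ (facePair j)
  k = faceOf (τ c) (τ d)
  σ-face : Fin 5 × Fin 5 → Fin 10
  σ-face p = faceOf (σ (proj₁ p)) (σ (proj₂ p))
  reorder : facePair k ≡ (τ c , τ d) ⊎ facePair k ≡ (τ d , τ c) → σ-face (τ c , τ d) ≡ σ-face (facePair k)
  reorder (inj₁ p) = cong σ-face (sym p)
  reorder (inj₂ p) = trans (faceOf-comm (σ (τ c)) (σ (τ d))) (cong σ-face (sym p))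

onFaces-inverse : ∀ σ σ⁻¹ → Injective _≡_ _≡_ σ⁻¹ → (∀ a → σ (σ⁻¹ a) ≡ a) →
                  ∀ k → onFaces σ (onFaces σ⁻¹ k) ≡ k
onFaces-inverse σ σ⁻¹ σ⁻¹-injective σσ⁻¹ k = begin
  onFaces σ (onFaces σ⁻¹ k) ≡⟨ onFaces-∘ σ σ⁻¹ σ⁻¹-injective k ⟨
  onFaces (σ ∘ σ⁻¹) k        ≡⟨ onFaces-cong σσ⁻¹ k ⟩
  onFaces id k               ≡⟨ onFaces-id k ⟩
  k                          ∎
  where open ≡-Reasoning

injectiveᵇ : (Fin 5 → Fin 5) → Bool
injectiveᵇ σ = allᵇ λ a → allᵇ λ b → (σ a == σ b) ⇒ᵇ (a == b)

injectiveᵇ-cong : ∀ {σ τ} → σ ≗ τ → injectiveᵇ σ ≡ injectiveᵇ τ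
injectiveᵇ-cong e = allᵇ-cong λ a → allᵇ-cong λ b → cong (λ x → x ⇒ᵇ (a == b)) (cong₂ _==_ (e a) (e b))

injectiveᵇ-sound : ∀ σ → T (injectiveᵇ σ) → Injective _≡_ _≡_ σ
injectiveᵇ-sound σ t {a} {b} σa≡σb = toWitness {a? = a Fin.≟ b} (⇒ᵇ-elim
  (allᵇ-sound (λ b → (σ a == σ b) ⇒ᵇ (a == b))
    (allᵇ-sound (λ a → allᵇ λ b → (σ a == σ b) ⇒ᵇ (a == b)) t a) b)
  (fromWitness {a? = σ a Fin.≟ σ b} σa≡σb))

injectiveᵇ-complete : ∀ σ → Injective _≡_ _≡_ σ → T (injectiveᵇ σ)
injectiveᵇ-complete σ σ-injective =
  allᵇ-complete (λ a → allᵇ λ b → (σ a == σ b) ⇒ᵇ (a == b)) λ a →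
    allᵇ-complete (λ b → (σ a == σ b) ⇒ᵇ (a == b)) (implication a)
  where
  implication : ∀ a b → T ((σ a == σ b) ⇒ᵇ (a == b))
  implication a b with σ a Fin.≟ σ b
  ... | yes σa≡σb = fromWitness {a? = a Fin.≟ b} (σ-injective σa≡σb)
  ... | no _      = tt

_∈ᵖ_ : Fin 5 → Fin 5 × Fin 5 → Bool
x ∈ᵖ (c , d) = (x == c) ∨ (x == d)

pointOf : (Fin 10 → Fin 10) → Fin 5 → Fin 5
pointOf h a = find λ c → allᵇ λ j → (a ∈ᵖ facePair j) ⇒ᵇ (c ∈ᵖ facePair (h j))

pointOf-cong : ∀ {h h'} → h ≗ h' → pointOf h ≗ pointOf h'
pointOf-cong e a = find-cong λ c → allᵇ-cong λ j →
  cong (λ k → (a ∈ᵖ facePair j) ⇒ᵇ (c ∈ᵖ facePair k)) (e j)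

recoversᵇ : (Fin 5 → Fin 5) → Bool
recoversᵇ σ = injectiveᵇ σ ⇒ᵇ allᵇ λ a → pointOf (memo (onFaces σ)) a == σ a

recoversᵇ-cong : ∀ {σ τ} → σ ≗ τ → recoversᵇ σ ≡ recoversᵇ τ
recoversᵇ-cong {σ} {τ} e = cong₂ _⇒ᵇ_ (injectiveᵇ-cong e) (allᵇ-cong recovers)
  where
  recovers : ∀ a → (pointOf (memo (onFaces σ)) a == σ a) ≡ (pointOf (memo (onFaces τ)) a == τ a)
  recovers a = cong₂ _==_ (pointOf-cong (memo-cong (onFaces-cong e)) a) (e a)

pointOf-recovers : allFunctionsᵇ recoversᵇ ≡ true
pointOf-recovers = refl

pointOf-onFaces : ∀ σ → Injective _≡_ _≡_ σ → ∀ a → pointOf (onFaces σ) a ≡ σ a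
pointOf-onFaces σ σ-injective a = trans (pointOf-cong (sym ∘ memo-correct (onFaces σ)) a)
  (toWitness {a? = pointOf (memo (onFaces σ)) a Fin.≟ σ a} (allᵇ-sound (λ a → pointOf (memo (onFaces σ)) a == σ a)
    (⇒ᵇ-elim {injectiveᵇ σ} recovered (injectiveᵇ-complete σ σ-injective)) a))
  where
  recovered : T (recoversᵇ σ)
  recovered = allFunctionsᵇ-sound recoversᵇ recoversᵇ-cong pointOf-recovers σ

onFaces-faithful : ∀ σ τ → Injective _≡_ _≡_ σ → Injective _≡_ _≡_ τ →
                   onFaces σ ≗ onFaces τ → σ ≗ τ
onFaces-faithful σ τ σ-injective τ-injective e a = begin
  σ a                  ≡⟨ pointOf-onFaces σ σ-injective a ⟨
  pointOf (onFaces σ) a ≡⟨ pointOf-cong e a ⟩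
  pointOf (onFaces τ) a ≡⟨ pointOf-onFaces τ τ-injective a ⟩
  τ a                  ∎
  where open ≡-Reasoning

-- Extending a permutation of the faces to the vertex classes

Transports : (Fin 10 → Fin 10) → Fin 6 → Fin 6 → Set
Transports h i i' = ∀ j → incident i j ≡ incident i' (h j)

transportsᵇ : (Fin 10 → Fin 10) → Fin 6 → Fin 6 → Bool
transportsᵇ h i i' = allᵇ λ j → isYes (incident i j Bool.≟ incident i' (h j))

transportsᵇ-sound : ∀ h i i' → T (transportsᵇ h i i') → Transports h i i'
transportsᵇ-sound h i i' t j = toWitness {a? = incident i j Bool.≟ incident i' (h j)}
  (allᵇ-sound (λ j → isYes (incident i j Bool.≟ incident i' (h j))) t j)

transportsᵇ-cong : ∀ {h h'} → h ≗ h' → ∀ i i' → transportsᵇ h i i' ≡ transportsᵇ h' i i'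
transportsᵇ-cong e i i' = allᵇ-cong λ j → cong (λ k → isYes (incident i j Bool.≟ incident i' k)) (e j)

onVertices : (Fin 10 → Fin 10) → Fin 6 → Fin 6
onVertices h i = find (transportsᵇ h i)

onVertices⁻¹ : (Fin 10 → Fin 10) → Fin 6 → Fin 6
onVertices⁻¹ h i' = find λ i → transportsᵇ h i i'

onVertices-cong : ∀ {h h'} → h ≗ h' → onVertices h ≗ onVertices h'
onVertices-cong e i = find-cong (transportsᵇ-cong e i)

onVertices⁻¹-cong : ∀ {h h'} → h ≗ h' → onVertices⁻¹ h ≗ onVertices⁻¹ h'
onVertices⁻¹-cong e i' = find-cong λ i → transportsᵇ-cong e i i'

extendsᵇ : (Fin 10 → Fin 10) → Bool
extendsᵇ h = allᵇ (λ i → transportsᵇ h i (onVertices h i))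
              ∧ allᵇ (λ i' → transportsᵇ h (onVertices⁻¹ h i') i')

extendsᵇ-cong : ∀ {h h'} → h ≗ h' → extendsᵇ h ≡ extendsᵇ h'
extendsᵇ-cong {h} {h'} e = cong₂ _∧_ (allᵇ-cong forward) (allᵇ-cong backward)
  where
  forward : ∀ i → transportsᵇ h i (onVertices h i) ≡ transportsᵇ h' i (onVertices h' i)
  forward i = trans (transportsᵇ-cong e i (onVertices h i))
                    (cong (transportsᵇ h' i) (onVertices-cong e i))
  backward : ∀ i' → transportsᵇ h (onVertices⁻¹ h i') i' ≡ transportsᵇ h' (onVertices⁻¹ h' i') i'
  backward i' = trans (transportsᵇ-cong e (onVertices⁻¹ h i') i')
                      (cong (λ i → transportsᵇ h' i i') (onVertices⁻¹-cong e i'))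

lift : (Fin 10 → Fin 10) → ΠVertex → ΠVertex
lift h (inj₁ i) = inj₁ (onVertices h i)
lift h (inj₂ j) = inj₂ (h j)

lift-cong : ∀ {h h'} → h ≗ h' → lift h ≗ lift h'
lift-cong e (inj₁ i) = cong inj₁ (onVertices-cong e i)
lift-cong e (inj₂ j) = cong inj₂ (e j)

module _ (h h⁻¹ : Fin 10 → Fin 10) (h-inverseˡ : ∀ k → h (h⁻¹ k) ≡ k) (h-inverseʳ : ∀ j → h⁻¹ (h j) ≡ j)
         (h-extends : T (extendsᵇ h)) where

  private
    forward-and-backward : T (allᵇ λ i → transportsᵇ h i (onVertices h i))
                         × T (allᵇ λ i' → transportsᵇ h (onVertices⁻¹ h i') i')
    forward-and-backward = Equivalence.to (T-∧ {allᵇ λ i → transportsᵇ h i (onVertices h i)}) h-extends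

    forward : ∀ i → Transports h i (onVertices h i)
    forward i = transportsᵇ-sound h i (onVertices h i)
      (allᵇ-sound (λ i → transportsᵇ h i (onVertices h i)) (proj₁ forward-and-backward) i)

    backward : ∀ i' → Transports h (onVertices⁻¹ h i') i'
    backward i' = transportsᵇ-sound h (onVertices⁻¹ h i') i'
      (allᵇ-sound (λ i' → transportsᵇ h (onVertices⁻¹ h i') i') (proj₂ forward-and-backward) i')

    target-unique : ∀ {i i' i''} → Transports h i i' → Transports h i i'' → i' ≡ i''
    target-unique {i} {i'} {i''} t t' = incident-injective i' i'' λ k → begin
      incident i' k            ≡⟨ cong (incident i') (h-inverseˡ k) ⟨
      incident i' (h (h⁻¹ k))  ≡⟨ t (h⁻¹ k) ⟨
      incident i (h⁻¹ k)       ≡⟨ t' (h⁻¹ k) ⟩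
      incident i'' (h (h⁻¹ k)) ≡⟨ cong (incident i'') (h-inverseˡ k) ⟩
      incident i'' k           ∎
      where open ≡-Reasoning

    source-unique : ∀ {i i₂ i'} → Transports h i i' → Transports h i₂ i' → i ≡ i₂
    source-unique {i} {i₂} t t₂ = incident-injective i i₂ λ j → trans (t j) (sym (t₂ j))

    lift⁻¹ : ΠVertex → ΠVertex
    lift⁻¹ (inj₁ i') = inj₁ (onVertices⁻¹ h i')
    lift⁻¹ (inj₂ k)  = inj₂ (h⁻¹ k)

    lift-lift⁻¹ : ∀ x → lift h (lift⁻¹ x) ≡ x
    lift-lift⁻¹ (inj₁ i') = cong inj₁
      (target-unique {onVertices⁻¹ h i'} (forward (onVertices⁻¹ h i')) (backward i'))
    lift-lift⁻¹ (inj₂ k)  = cong inj₂ (h-inverseˡ k)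

    lift⁻¹-lift : ∀ x → lift⁻¹ (lift h x) ≡ x
    lift⁻¹-lift (inj₁ i) = cong inj₁
      (source-unique {i' = onVertices h i} (backward (onVertices h i)) (forward i))
    lift⁻¹-lift (inj₂ j) = cong inj₂ (h-inverseʳ j)

    lift-adj : ∀ x y → adj x y ≡ adj (lift h x) (lift h y)
    lift-adj (inj₁ i) (inj₂ j) = forward i j
    lift-adj (inj₂ j) (inj₁ i) = forward i j
    lift-adj (inj₁ _) (inj₁ _) = refl
    lift-adj (inj₂ _) (inj₂ _) = refl

  liftAut : Aut
  liftAut = record
    { perm     = mk↔ₛ′ (lift h) lift⁻¹ lift-lift⁻¹ lift⁻¹-lift
    ; preserve = Adj-preserved (lift h) lift-adj
    }

-- Even permutations are realised by automorphisms

inversion : Fin 5 → Fin 5 → Fin 5 → Fin 5 → ℕ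
inversion i j x y = if does (i <? j) then (if does (y <? x) then 1 else 0) else 0

inversionsOf : (Fin 5 → Fin 5) → ℕ
inversionsOf σ = sum (map (λ i → sum (map (λ j → inversion i j (σ i) (σ j)) (allFin 5))) (allFin 5))

inversionsOf-cong : ∀ {σ τ} → σ ≗ τ → inversionsOf σ ≡ inversionsOf τ
inversionsOf-cong e = cong sum (map-cong (λ i → cong sum (map-cong (λ j →
  cong₂ (inversion i j) (e i) (e j)) (allFin 5))) (allFin 5))

inversions-≡ : ∀ π → inversions π ≡ inversionsOf (π ⟨$⟩ʳ_)
inversions-≡ π = refl

evenᵇ : (Fin 5 → Fin 5) → Bool
evenᵇ σ = isYes (inversionsOf σ % 2 ℕ.≟ 0)

evenᵇ-cong : ∀ {σ τ} → σ ≗ τ → evenᵇ σ ≡ evenᵇ τ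
evenᵇ-cong {σ} {τ} e = cong (λ n → isYes (n % 2 ℕ.≟ 0)) {inversionsOf σ} {inversionsOf τ} (inversionsOf-cong e)

realisableᵇ : (Fin 5 → Fin 5) → Bool
realisableᵇ σ = (injectiveᵇ σ ∧ evenᵇ σ) ⇒ᵇ extendsᵇ (memo (onFaces σ))

realisableᵇ-cong : ∀ {σ τ} → σ ≗ τ → realisableᵇ σ ≡ realisableᵇ τ
realisableᵇ-cong {σ} {τ} e = cong₂ _⇒ᵇ_
  (cong₂ _∧_ (injectiveᵇ-cong e) (evenᵇ-cong e))
  (extendsᵇ-cong {memo (onFaces σ)} {memo (onFaces τ)} (memo-cong (onFaces-cong e)))

even-permutations-realisable : allFunctionsᵇ realisableᵇ ≡ true
even-permutations-realisable = refl

onFaces-extends : ∀ σ → Injective _≡_ _≡_ σ → inversionsOf σ % 2 ≡ 0 → T (extendsᵇ (onFaces σ))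
onFaces-extends σ σ-injective σ-even =
  subst T (extendsᵇ-cong {memo (onFaces σ)} {onFaces σ} (memo-correct (onFaces σ))) memoised
  where
  premise : T (injectiveᵇ σ ∧ evenᵇ σ)
  premise = Equivalence.from (T-∧ {injectiveᵇ σ} {evenᵇ σ})
    (injectiveᵇ-complete σ σ-injective , fromWitness {a? = inversionsOf σ % 2 ℕ.≟ 0} σ-even)
  realisable : T (realisableᵇ σ)
  realisable = allFunctionsᵇ-sound realisableᵇ realisableᵇ-cong even-permutations-realisable σ
  memoised : T (extendsᵇ (memo (onFaces σ)))
  memoised = ⇒ᵇ-elim {injectiveᵇ σ ∧ evenᵇ σ} {extendsᵇ (memo (onFaces σ))} realisable premise

act : A₅ → Fin 5 → Fin 5
act σ = proj₁ σ ⟨$⟩ʳ_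

realise : (Fin 5 → Fin 5) → ΠVertex → ΠVertex
realise σ = lift (onFaces σ)

realisation : A₅ → Aut
realisation (π , π-even) = liftAut (onFaces σ) (onFaces σ⁻¹)
  (onFaces-inverse σ σ⁻¹ (to-injective (flip π)) (λ a → inverseʳ π))
  (onFaces-inverse σ⁻¹ σ (to-injective π) (λ a → inverseˡ π))
  (onFaces-extends σ (to-injective π) (subst (λ n → n % 2 ≡ 0) (inversions-≡ π) π-even))
  where
  σ σ⁻¹ : Fin 5 → Fin 5
  σ   = π ⟨$⟩ʳ_
  σ⁻¹ = π ⟨$⟩ˡ_

-- Automorphisms are realised by even permutations

_≟Π_ : DecidableEquality ΠVertex
_≟Π_ = Sum.≡-dec Fin._≟_ Fin._≟_

allΠ : List ΠVertex
allΠ = map inj₁ (allFin 6) ++ map inj₂ (allFin 10)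

∈-allΠ : ∀ x → x ∈ allΠ
∈-allΠ (inj₁ i) = ∈-++⁺ˡ (∈-map⁺ inj₁ (∈-allFin i))
∈-allΠ (inj₂ j) = ∈-++⁺ʳ (map inj₁ (allFin 6)) (∈-map⁺ inj₂ (∈-allFin j))

preimage : (Fin 5 → Fin 5) → Fin 5 → Fin 5
preimage σ a = find λ b → σ b == a

isEvenPermutationᵇ : (Fin 5 → Fin 5) → Bool
isEvenPermutationᵇ σ = injectiveᵇ σ ∧ allᵇ (λ a → σ (preimage σ a) == a) ∧ evenᵇ σ

evenPermutation : (σ : Fin 5 → Fin 5) → T (isEvenPermutationᵇ σ) → A₅
evenPermutation σ t = π , π-even
  where
  σ-injective : Injective _≡_ _≡_ σ
  σ-injective = injectiveᵇ-sound σ (proj₁ (Equivalence.to (T-∧ {injectiveᵇ σ}) t))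
  rest : T (allᵇ (λ a → σ (preimage σ a) == a)) × T (evenᵇ σ)
  rest = Equivalence.to (T-∧ {allᵇ (λ a → σ (preimage σ a) == a)} {evenᵇ σ})
                        (proj₂ (Equivalence.to (T-∧ {injectiveᵇ σ}) t))
  σ-preimage : ∀ a → σ (preimage σ a) ≡ a
  σ-preimage a = toWitness {a? = σ (preimage σ a) Fin.≟ a}
    (allᵇ-sound (λ a → σ (preimage σ a) == a) (proj₁ rest) a)
  π : Permutation′ 5
  π = mk↔ₛ′ σ (preimage σ) σ-preimage (λ b → σ-injective (σ-preimage (σ b)))
  π-even : IsEven π
  π-even = trans (cong (_% 2) (trans (inversions-≡ π) (inversionsOf-cong {π ⟨$⟩ʳ_} {σ} λ _ → refl)))
                 (toWitness {a? = inversionsOf σ % 2 ℕ.≟ 0} (proj₂ rest))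

facePart : ΠVertex → Fin 10
facePart (inj₁ _) = zero
facePart (inj₂ j) = j

candidatePermutation : (ΠVertex → ΠVertex) → Fin 5 → Fin 5
candidatePermutation g = memo (pointOf (memo (facePart ∘ g ∘ inj₂)))

realisesᵇ : (ΠVertex → ΠVertex) → (Fin 5 → Fin 5) → Bool
realisesᵇ g σ = isEvenPermutationᵇ σ ∧ all (λ x → isYes (g x ≟Π lift (memo (onFaces σ)) x)) allΠ

realisesᵇ-sound : ∀ g σ → T (realisesᵇ g σ) → T (isEvenPermutationᵇ σ) × g ≗ realise σ
realisesᵇ-sound g σ t = proj₁ parts , λ x → trans (agrees x) (lift-cong (memo-correct (onFaces σ)) x)
  where
  parts : T (isEvenPermutationᵇ σ) × T (all (λ x → isYes (g x ≟Π lift (memo (onFaces σ)) x)) allΠ)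
  parts = Equivalence.to (T-∧ {isEvenPermutationᵇ σ}) t
  agrees : g ≗ lift (memo (onFaces σ))
  agrees x = toWitness {a? = g x ≟Π lift (memo (onFaces σ)) x}
    (T-all (λ x → isYes (g x ≟Π lift (memo (onFaces σ)) x)) (proj₂ parts) (∈-allΠ x))

open Backtracking _≟Π_ allΠ ∈-allΠ adj (λ g → realisesᵇ g (candidatePermutation g))
  using (searchᵇ; search-sound)

-- Any order listing every vertex would do; this one keeps the search tree small.
searchOrder : List ΠVertex
searchOrder = inj₁ (# 5) ∷ inj₂ (# 8) ∷ inj₁ (# 4) ∷ inj₂ (# 9) ∷ inj₂ (# 5) ∷ inj₁ (# 3)
            ∷ inj₂ (# 4) ∷ inj₁ (# 1) ∷ inj₂ (# 0) ∷ inj₂ (# 7) ∷ inj₁ (# 0) ∷ inj₂ (# 1)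
            ∷ inj₂ (# 6) ∷ inj₁ (# 2) ∷ inj₂ (# 3) ∷ inj₂ (# 2) ∷ []

automorphisms-searched : searchᵇ searchOrder [] ≡ true
automorphisms-searched = refl

classification : (a : Aut) → Σ[ σ ∈ A₅ ] Inverse.to (perm a) ≗ realise (act σ)
classification a = fromLeaf (search-sound f (aut-adj a) (to-injective (perm a))
                                           searchOrder automorphisms-searched)
  where
  f : ΠVertex → ΠVertex
  f = Inverse.to (perm a)
  fromLeaf : ∃[ g ] f ≗ g × T (realisesᵇ g (candidatePermutation g)) →
             Σ[ σ ∈ A₅ ] f ≗ realise (act σ)
  fromLeaf (g , f≗g , t) = evenPermutation σ (proj₁ r) , λ x → trans (f≗g x) (proj₂ r x)
    where
    σ : Fin 5 → Fin 5
    σ = candidatePermutation g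
    r : T (isEvenPermutationᵇ σ) × g ≗ realise σ
    r = realisesᵇ-sound g σ t

act-injective : ∀ σ → Injective _≡_ _≡_ (act σ)
act-injective σ = to-injective (proj₁ σ)

classify : Aut → A₅
classify a = proj₁ (classification a)

classify-sound : ∀ a → Inverse.to (perm a) ≗ realise (act (classify a))
classify-sound a = proj₂ (classification a)

classify-unique : ∀ a σ → Injective _≡_ _≡_ σ →
                 (∀ j → Inverse.to (perm a) (inj₂ j) ≡ inj₂ (onFaces σ j)) → act (classify a) ≗ σ
classify-unique a σ σ-injective e = onFaces-faithful (act (classify a)) σ (act-injective (classify a)) σ-injective
  λ j → inj₂-injective (trans (sym (classify-sound a (inj₂ j))) (e j))

classify-∘ : ∀ a b j → Inverse.to (perm (a ∘Aut b)) (inj₂ j)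
                       ≡ inj₂ (onFaces (act (classify a) ∘ act (classify b)) j)
classify-∘ a b j = begin
  Inverse.to (perm a) (Inverse.to (perm b) (inj₂ j))
    ≡⟨ cong (Inverse.to (perm a)) (classify-sound b (inj₂ j)) ⟩
  Inverse.to (perm a) (inj₂ (onFaces σ j))
    ≡⟨ classify-sound a (inj₂ (onFaces σ j)) ⟩
  inj₂ (onFaces τ (onFaces σ j))
    ≡⟨ cong inj₂ (onFaces-∘ τ σ (act-injective (classify b)) j) ⟨
  inj₂ (onFaces (τ ∘ σ) j)
    ∎
  where
  open ≡-Reasoning
  σ τ : Fin 5 → Fin 5
  σ = act (classify b)
  τ = act (classify a)

proposition2p3 : AutIsoA₅
proposition2p3 = record
  { to        = classify
  ; from      = realisation
  ; to-cong   = λ {a} {b} a≈b → classify-unique a (act (classify b)) (act-injective (classify b))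
                                  λ j → trans (a≈b (inj₂ j)) (classify-sound b (inj₂ j))
  ; from-cong = λ σ≈τ → lift-cong (onFaces-cong σ≈τ)
  ; to-from   = λ σ → classify-unique (realisation σ) (act σ) (act-injective σ) λ _ → refl
  ; from-to   = λ a x → sym (classify-sound a x)
  ; homo      = λ a b → classify-unique (a ∘Aut b) (act (classify a) ∘ act (classify b))
                          (act-injective (classify b) ∘ act-injective (classify a)) (classify-∘ a b)
  }
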